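{- Let $(T,s)$ be a parking function, where $T$ is a rooted tree on vertex set $[n]$ and $s\in[n]^n$. An edge $e=(u,v)$ of $T$ is used by $s$ if and only if $|T_u| < |\{i : s_i \in V(T_u)\}|$. Furthermore, the set of edges used by $s$ is invariant under permutations of the entries of $s$.
   Context: A rooted tree $T$ on vertex set $[n]$ has all edges oriented towards the root; an edge $u\to v$ ($v$ the parent of $u$) is written $(u,v)$. Given $s\in[n]^n$, drivers $1,\dots,n$ arrive in order; driver $i$ goes to $s_i$ and parks there if unoccupied; otherwise she travels along the directed path towards the root and parks at the first unoccupied vertex; if none, she leaves. $(T,s)$ is a parking function if all drivers park. For $w\in[n]$, $T_w$ is the subtree induced by vertices having a directed path (possibly of length $0$) to $w$. An edge $e$ is used by $s$ if some driver, after failing to park at her preferred vertex, crosses $e$ during her search for an unoccupied vertex. -}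

module Defs where

open import Data.Nat using (ℕ; zero; suc; _<_)
open import Data.Fin using (Fin; _≟_)
open import Data.Fin.Subset using (Subset; _∈_; ∣_∣)
open import Data.Fin.Subset.Properties using (_∈?_)
open import Data.Bool using (Bool; true; false; if_then_else_; not)
open import Data.Maybe using (Maybe; just; nothing)
open import Data.List using (List; []; _∷_; _++_; tabulate)
open import Data.List.Membership.Propositional using () renaming (_∈_ to _∈ₗ_)
open import Data.Product using (Σ; _×_; _,_; ∃)
open import Data.Vec using () renaming (tabulate to vtabulate)
open import Relation.Nullary using (does)
open import Relation.Binary.PropositionalEquality using (_≡_)

-- A rooted tree on vertex set Fin n is given by its parent map:
-- parent v = just w  means the edge (v , w), i.e. v → w;  parent r = nothing  for the root r.
Parent : ℕ → Set
Parent n = Fin n → Maybe (Fin n)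

step : ∀ {n} → Parent n → Maybe (Fin n) → Maybe (Fin n)
step par nothing  = nothing
step par (just v) = par v

iter : ∀ {n} → Parent n → ℕ → Maybe (Fin n) → Maybe (Fin n)
iter par zero    x = x
iter par (suc k) x = step par (iter par k x)

IsRootedTree : ∀ {n} → Parent n → Set
IsRootedTree {n} par =
  (Σ (Fin n) λ r → (par r ≡ nothing) × (∀ w → par w ≡ nothing → w ≡ r))
  × (∀ v → ∃ λ k → iter par k (just v) ≡ nothing)

-- w ∈ V(T_u): there is a directed path (possibly of length 0) from w to u
Reach : ∀ {n} → Parent n → Fin n → Fin n → Set
Reach par w u = ∃ λ k → iter par k (just w) ≡ just u

Occ : ℕ → Set
Occ n = Fin n → Bool

occupy : ∀ {n} → Occ n → Fin n → Occ n
occupy occ v w = if does (w ≟ v) then true else occ w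

-- Search of one driver, starting at vertex v, with fuel (fuel n suffices in a
-- rooted tree since every path towards the root has at most n vertices).
-- Returns the parking spot (if any) and the list of vertices u whose outgoing
-- edge (u , parent u) was crossed.
search : ∀ {n} → Parent n → Occ n → ℕ → Fin n → Maybe (Fin n) × List (Fin n)
search par occ zero v = nothing , []
search par occ (suc k) v with occ v
... | false = just v , []
... | true with par v
...   | nothing = nothing , []
...   | just p with search par occ k p
...     | (r , es) = r , v ∷ es

run : ∀ {n} → Parent n → Occ n → List (Fin n) → Bool × List (Fin n)
run par occ [] = true , []
run {n} par occ (x ∷ xs) with search par occ n x
... | (nothing , es) with run par occ xs
...   | (b , es') = false , es ++ es'
run {n} par occ (x ∷ xs) | (just p , es) with run par (occupy occ p) xs
...   | (b , es') = b , es ++ es'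

emptyOcc : ∀ {n} → Occ n
emptyOcc _ = false

drivers : ∀ {n} → (Fin n → Fin n) → List (Fin n)
drivers s = tabulate s

IsParkingFunction : ∀ {n} → Parent n → (Fin n → Fin n) → Set
IsParkingFunction par s = Data.Product.proj₁ (run par emptyOcc (drivers s)) ≡ true
  where import Data.Product

-- the edge (u , parent u) is used by s
Used : ∀ {n} → Parent n → (Fin n → Fin n) → Fin n → Set
Used par s u = u ∈ₗ Data.Product.proj₂ (run par emptyOcc (drivers s))
  where import Data.Product

preimage : ∀ {n} → (Fin n → Fin n) → Subset n → Subset n
preimage s A = vtabulate λ i → does (s i ∈? A)

-- Let A = T_u and follow  load + demand  along the run, where load counts the occupied vertices
-- of A and demand the drivers still to come whose preferred vertex lies in A.  A driver preferring
-- a vertex outside A never parks in A, because A contains all descendants of its vertices.  A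
-- driver preferring A parks in A unless she crosses (u, v), and then she parks outside A, because
-- v does not reach back into A.  So the quantity is constant except for a drop of one per
-- crossing of (u, v).  For a parking function every vertex ends up occupied, hence (u, v) is used
-- iff |A| < |{i : s_i ∈ A}|.  The same bookkeeping shows that (T, s) is a parking function iff
-- |T_w| ≤ |{i : s_i ∈ T_w}| for all w (if w stays free, every driver preferring T_w parks in T_w).
-- These counts are invariant under permuting s, so the first part applies to s ∘ σ as well.
module Submission where

open import Defs
open import Algebra.Properties.CommutativeMonoid.Sum as CommutativeMonoidSum using ()
open import Data.Bool using (Bool; true; false; not; _∧_; f≤t; b≤b) renaming (_≤_ to _≤ᵇ_)
open import Data.Bool.Properties using (∧-zeroʳ; not-involutive)
  renaming (≤-refl to ≤ᵇ-refl; ≤-minimum to ≤ᵇ-minimum; ≤-maximum to ≤ᵇ-maximum)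
open import Data.Empty using (⊥-elim)
open import Data.Fin using (Fin; zero; suc; toℕ; fromℕ<) renaming (_≟_ to _≟ᶠ_)
open import Data.Fin.Permutation using (Permutation′; _⟨$⟩ʳ_)
open import Data.Fin.Properties using (pigeonhole; any?; toℕ<n; toℕ-fromℕ<) renaming (suc-injective to fsuc-injective)
open import Data.Fin.Subset using (Subset; _∈_; _∉_; ∣_∣)
open import Data.Fin.Subset.Properties using (_∈?_)
open import Data.Maybe using (Maybe; just; nothing; fromMaybe; is-just)
open import Data.Maybe.Properties using (just-injective; ≡-dec)
open import Data.Nat using (ℕ; zero; suc; _+_; _*_; _∸_; _≤_; _<_; z≤n; s≤s)
open import Data.Nat.Induction using (<-rec)
open import Data.Nat.Properties
open import Data.Product using (_×_; _,_; proj₁; proj₂; ∃)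
open import Data.Sum using (_⊎_; inj₁; inj₂; map₁)
open import Data.List using (List; []; _∷_; _++_; length; tabulate)
open import Data.List.Properties using (length-tabulate)
open import Data.List.Relation.Unary.Any using (here; there)
open import Data.List.Membership.Propositional using () renaming (_∈_ to _∈ₗ_; _∉_ to _∉ₗ_)
open import Data.List.Membership.Propositional.Properties using (∈-++⁺ˡ; ∈-++⁺ʳ; ∈-++⁻)
open import Data.Vec using (lookup) renaming ([] to []ᵛ; _∷_ to _∷ᵛ_; tabulate to vtabulate)
open import Data.Vec.Properties using (lookup∘tabulate; []=⇒lookup; lookup⇒[]=)
open import Function using (_∘_; case_of_; _⇔_; mk⇔; Equivalence)
open Equivalence using (to; from)
open import Function.Properties.Equivalence using () renaming (sym to ⇔-sym; trans to ⇔-trans)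
open import Relation.Nullary using (Dec; ¬_; yes; no; does)
open import Relation.Nullary.Decidable using (dec-true; dec-false)
open import Relation.Binary.PropositionalEquality

bit : Bool → ℕ
bit true  = 1
bit false = 0

bit≤1 : ∀ b → bit b ≤ 1
bit≤1 false = z≤n
bit≤1 true  = ≤-refl

∧-true : ∀ {a b} → a ∧ b ≡ true → a ≡ true × b ≡ true
∧-true {true} b≡true = refl , b≡true

∧-false : ∀ {a b} → a ∧ b ≡ false → a ≡ false ⊎ b ≡ false
∧-false {false} _       = inj₁ refl
∧-false {true}  b≡false = inj₂ b≡false

≤ᵇ-false : ∀ {a b} → a ≤ᵇ b → b ≡ false → a ≡ false
≤ᵇ-false b≤b b≡false = b≡false

∧-≤ʳ : ∀ a b → a ∧ b ≤ᵇ b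
∧-≤ʳ false b = ≤ᵇ-minimum b
∧-≤ʳ true  b = ≤ᵇ-refl

∧-monoˡ : ∀ {a a′ b} → a ≤ᵇ a′ → a ∧ b ≤ᵇ a′ ∧ b
∧-monoˡ {b = b} f≤t = ≤ᵇ-minimum b
∧-monoˡ         b≤b = ≤ᵇ-refl

bit-mono : ∀ {a b} → a ≤ᵇ b → bit a ≤ bit b
bit-mono f≤t = z≤n
bit-mono b≤b = ≤-refl

module ℕ-Sum = CommutativeMonoidSum +-0-commutativeMonoid

count : ∀ {m} → (Fin m → Bool) → ℕ
count f = ℕ-Sum.sum (bit ∘ f)

count-cong : ∀ {m} {f g : Fin m → Bool} → (∀ i → f i ≡ g i) → count f ≡ count g
count-cong f≗g = ℕ-Sum.sum-cong-≗ (cong bit ∘ f≗g)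

count-permute : ∀ {m} (f : Fin m → Bool) (σ : Permutation′ m) → count f ≡ count (f ∘ (σ ⟨$⟩ʳ_))
count-permute f σ = ℕ-Sum.sum-permute (bit ∘ f) σ

count-mono : ∀ {m} {f g : Fin m → Bool} → (∀ i → f i ≤ᵇ g i) → count f ≤ count g
count-mono {zero}  f≤g = z≤n
count-mono {suc m} f≤g = +-mono-≤ (bit-mono (f≤g zero)) (count-mono (f≤g ∘ suc))

count-mono-< : ∀ {m} {f g : Fin m → Bool} → (∀ i → f i ≤ᵇ g i) →
               ∀ p → f p ≡ false → g p ≡ true → count f < count g
count-mono-< {suc m} {f} {g} f≤g zero fp gp rewrite fp | gp = s≤s (count-mono (f≤g ∘ suc))
count-mono-< {suc m} f≤g (suc p) fp gp =
  +-mono-≤-< (bit-mono (f≤g zero)) (count-mono-< (f≤g ∘ suc) p fp gp)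

count-insert : ∀ {m} {f g : Fin m → Bool} p → f p ≡ false → g p ≡ true →
               (∀ i → i ≢ p → f i ≡ g i) → count g ≡ suc (count f)
count-insert {suc m} {f} {g} zero fp gp f≡g rewrite fp | gp =
  cong suc (count-cong (λ i → sym (f≡g (suc i) λ ())))
count-insert {suc m} {f} {g} (suc p) fp gp f≡g = begin
  bit (g zero) + count (g ∘ suc)        ≡⟨ cong₂ _+_ (cong bit (sym (f≡g zero λ ())))
                                             (count-insert p fp gp (λ i i≢p → f≡g (suc i) (i≢p ∘ fsuc-injective))) ⟩
  bit (f zero) + suc (count (f ∘ suc))  ≡⟨ +-suc (bit (f zero)) _ ⟩
  suc (count f)                         ∎
  where open ≡-Reasoning

count-witness : ∀ {m} (f : Fin m → Bool) → 0 < count f → ∃ λ i → f i ≡ true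
count-witness {suc m} f 0<c with f zero in f0≡
... | true  = zero , f0≡
... | false = let (i , fi) = count-witness (f ∘ suc) 0<c in suc i , fi

count-const-false : ∀ m → count {m} (λ _ → false) ≡ 0
count-const-false zero    = refl
count-const-false (suc m) = count-const-false m

count-const-true : ∀ m → count {m} (λ _ → true) ≡ m
count-const-true zero    = refl
count-const-true (suc m) = cong suc (count-const-true m)

count-pos : ∀ {m} (f : Fin m → Bool) i → f i ≡ true → 0 < count f
count-pos {m} f i fi = subst (_< count f) (count-const-false m)
  (count-mono-< (λ _ → ≤ᵇ-minimum _) i refl fi)

∣tabulate∣≡count : ∀ {m} (f : Fin m → Bool) → ∣ vtabulate f ∣ ≡ count f
∣tabulate∣≡count {zero}  f = refl
∣tabulate∣≡count {suc m} f with f zero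
... | true  = cong suc (∣tabulate∣≡count (f ∘ suc))
... | false = ∣tabulate∣≡count (f ∘ suc)

∣A∣≡count-∈ : ∀ {m} (A : Subset m) → ∣ A ∣ ≡ count (λ w → does (w ∈? A))
∣A∣≡count-∈ []ᵛ          = refl
∣A∣≡count-∈ (true ∷ᵛ A)  = cong suc (∣A∣≡count-∈ A)
∣A∣≡count-∈ (false ∷ᵛ A) = ∣A∣≡count-∈ A

module _ {n : ℕ} where

  free : Occ n → ℕ
  free occ = count (not ∘ occ)

  load : Subset n → Occ n → ℕ
  load A occ = count (λ w → occ w ∧ does (w ∈? A))

  occupy-self : ∀ (occ : Occ n) p → occupy occ p p ≡ true
  occupy-self occ p rewrite dec-true (p ≟ᶠ p) refl = refl

  occupy-other : ∀ (occ : Occ n) {p w} → w ≢ p → occupy occ p w ≡ occ w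
  occupy-other occ {p} {w} w≢p rewrite dec-false (w ≟ᶠ p) w≢p = refl

  occupy-≤ : ∀ (occ : Occ n) p w → occ w ≤ᵇ occupy occ p w
  occupy-≤ occ p w with w ≟ᶠ p
  ... | yes _ = ≤ᵇ-maximum (occ w)
  ... | no  _ = ≤ᵇ-refl

  free-empty : free emptyOcc ≡ n
  free-empty = count-const-true n

  free-occupy : ∀ (occ : Occ n) p → occ p ≡ false → free occ ≡ suc (free (occupy occ p))
  free-occupy occ p occp = count-insert p (cong not (occupy-self occ p)) (cong not occp)
    (λ w w≢p → cong not (occupy-other occ w≢p))

  free≡0⇒full : ∀ (occ : Occ n) → free occ ≡ 0 → ∀ w → occ w ≡ true
  free≡0⇒full occ free≡0 w with occ w in occw
  ... | true  = refl
  ... | false = ⊥-elim (<⇒≢ (count-pos (not ∘ occ) w (cong not occw)) (sym free≡0))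

  load-empty : ∀ A → load A emptyOcc ≡ 0
  load-empty A = count-const-false n

  load<∣A∣ : ∀ {A} (occ : Occ n) {w} → w ∈ A → occ w ≡ false → load A occ < ∣ A ∣
  load<∣A∣ {A} occ {w} w∈A occw = subst (load A occ <_) (sym (∣A∣≡count-∈ A))
    (count-mono-< (λ w → ∧-≤ʳ (occ w) _) w (cong (_∧ _) occw) (dec-true (w ∈? A) w∈A))

  load-full : ∀ A (occ : Occ n) → (∀ w → occ w ≡ true) → load A occ ≡ ∣ A ∣
  load-full A occ full = trans (count-cong λ w → cong (_∧ _) (full w)) (sym (∣A∣≡count-∈ A))

  load-occupy-∈ : ∀ {A} (occ : Occ n) {p} → occ p ≡ false → p ∈ A → load A (occupy occ p) ≡ suc (load A occ)
  load-occupy-∈ {A} occ {p} occp p∈A = count-insert p (cong (_∧ _) occp)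
    (trans (cong (_∧ _) (occupy-self occ p)) (dec-true (p ∈? A) p∈A))
    (λ w w≢p → sym (cong (_∧ _) (occupy-other occ w≢p)))

  load-occupy-∉ : ∀ {A} (occ : Occ n) {p} → p ∉ A → load A (occupy occ p) ≡ load A occ
  load-occupy-∉ {A} occ {p} p∉A = count-cong agree
    where
      agree : ∀ w → occupy occ p w ∧ does (w ∈? A) ≡ occ w ∧ does (w ∈? A)
      agree w with w ≟ᶠ p
      ... | yes refl rewrite dec-false (w ∈? A) p∉A = sym (∧-zeroʳ (occ w))
      ... | no  _    = refl

  load-occupy-≥ : ∀ A (occ : Occ n) p → load A occ ≤ load A (occupy occ p)
  load-occupy-≥ A occ p = count-mono λ w → ∧-monoˡ (occupy-≤ occ p w)

module Paths {n : ℕ} (par : Parent n) where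

  iter-nothing : ∀ k → iter par k nothing ≡ nothing
  iter-nothing zero    = refl
  iter-nothing (suc k) = cong (step par) (iter-nothing k)

  iter-+ : ∀ a b x → iter par (a + b) x ≡ iter par a (iter par b x)
  iter-+ zero    b x = refl
  iter-+ (suc a) b x = cong (step par) (iter-+ a b x)

  iter-suc : ∀ k x → iter par (suc k) (just x) ≡ iter par k (par x)
  iter-suc k x = trans (cong (λ i → iter par i (just x)) (+-comm 1 k)) (iter-+ k 1 (just x))

  iter-nothing-≤ : ∀ {a b x} → a ≤ b → iter par a x ≡ nothing → iter par b x ≡ nothing
  iter-nothing-≤ {a} {b} {x} a≤b ≡nothing = begin
    iter par b x                    ≡⟨ cong (λ i → iter par i x) (m∸n+n≡m a≤b) ⟨
    iter par (b ∸ a + a) x          ≡⟨ iter-+ (b ∸ a) a x ⟩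
    iter par (b ∸ a) (iter par a x) ≡⟨ cong (iter par (b ∸ a)) ≡nothing ⟩
    iter par (b ∸ a) nothing        ≡⟨ iter-nothing (b ∸ a) ⟩
    nothing                         ∎
    where open ≡-Reasoning

  reach-refl : ∀ {u} → Reach par u u
  reach-refl = 0 , refl

  reach-trans : ∀ {x y z} → Reach par x y → Reach par y z → Reach par x z
  reach-trans {x} (j , x→y) (k , y→z) = k + j , trans (iter-+ k j (just x)) (trans (cong (iter par k) x→y) y→z)

  reach-parent : ∀ {x y} → par x ≡ just y → Reach par x y
  reach-parent x→y = 1 , x→y

  path-from-root : ∀ {x u} j → par x ≡ nothing → iter par j (just x) ≡ just u → x ≡ u
  path-from-root zero    _    x→u = just-injective x→u
  path-from-root (suc j) root x→u with () ← trans (sym (iter-nothing-≤ {1} {suc j} (s≤s z≤n) root)) x→u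

  path-tail : ∀ {x q u} j → iter par j (just x) ≡ just u → x ≢ u → par x ≡ just q →
              ∃ λ j′ → j ≡ suc j′ × iter par j′ (just q) ≡ just u
  path-tail zero    x→u x≢u _    = ⊥-elim (x≢u (just-injective x→u))
  path-tail {x} (suc j) x→u _ x→q = j , refl , trans (sym (trans (iter-suc j x) (cong (iter par j) x→q))) x→u

  path-shorten : ∀ {x u} j → n ≤ j → iter par j (just x) ≡ just u →
                 ∃ λ j′ → j′ < j × iter par j′ (just x) ≡ just u
  path-shorten {x} {u} j n≤j x→u =
    let (a , b , a<b , same) = pigeonhole (n<1+n n) vertex
        b≤j = ≤-trans (≤-pred (toℕ<n b)) n≤j
        a≤j = ≤-trans (<⇒≤ a<b) b≤j
    in j ∸ toℕ b + toℕ a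
     , <-≤-trans (+-monoʳ-< (j ∸ toℕ b) a<b) (≤-reflexive (m∸n+n≡m b≤j))
     , (begin
         iter par (j ∸ toℕ b + toℕ a) (just x)           ≡⟨ iter-+ (j ∸ toℕ b) (toℕ a) (just x) ⟩
         iter par (j ∸ toℕ b) (iter par (toℕ a) (just x)) ≡⟨ cong (iter par (j ∸ toℕ b)) (on-path a≤j) ⟩
         iter par (j ∸ toℕ b) (just (vertex a))           ≡⟨ cong (iter par (j ∸ toℕ b) ∘ just) same ⟩
         iter par (j ∸ toℕ b) (just (vertex b))           ≡⟨ cong (iter par (j ∸ toℕ b)) (on-path b≤j) ⟨
         iter par (j ∸ toℕ b) (iter par (toℕ b) (just x)) ≡⟨ iter-+ (j ∸ toℕ b) (toℕ b) (just x) ⟨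
         iter par (j ∸ toℕ b + toℕ b) (just x)           ≡⟨ cong (λ i → iter par i (just x)) (m∸n+n≡m b≤j) ⟩
         iter par j (just x)                              ≡⟨ x→u ⟩
         just u                                           ∎)
    where
      open ≡-Reasoning
      vertex : Fin (suc n) → Fin n
      vertex i = fromMaybe x (iter par (toℕ i) (just x))
      on-path : ∀ {i} → toℕ i ≤ j → iter par (toℕ i) (just x) ≡ just (vertex i)
      on-path {i} i≤j with iter par (toℕ i) (just x) in x→
      ... | just _  = refl
      ... | nothing with () ← trans (sym (iter-nothing-≤ i≤j x→)) x→u

  path-bounded : ∀ {x u} j → iter par j (just x) ≡ just u → ∃ λ k → k < n × iter par k (just x) ≡ just u
  path-bounded {x} {u} = <-rec Bounded bound
    where
      Bounded : ℕ → Set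
      Bounded j = iter par j (just x) ≡ just u → ∃ λ k → k < n × iter par k (just x) ≡ just u
      bound : ∀ j → (∀ {i} → i < j → Bounded i) → Bounded j
      bound j shorter x→u with j <? n
      ... | yes j<n = j , j<n , x→u
      ... | no  j≮n = let (j′ , j′<j , x→′u) = path-shorten j (≮⇒≥ j≮n) x→u in shorter j′<j x→′u

  reach? : ∀ w u → Dec (Reach par w u)
  reach? w u with any? (λ (k : Fin n) → ≡-dec _≟ᶠ_ (iter par (toℕ k) (just w)) (just u))
  ... | yes (k , w→u) = yes (toℕ k , w→u)
  ... | no  ¬short    = no λ (j , w→u) →
    let (k , k<n , w→′u) = path-bounded j w→u
    in ¬short (fromℕ< k<n , subst (λ i → iter par i (just w) ≡ just u) (sym (toℕ-fromℕ< k<n)) w→′u)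

  subtree : Fin n → Subset n
  subtree u = vtabulate λ w → does (reach? w u)

  ∈-subtree : ∀ {u} w → w ∈ subtree u ⇔ Reach par w u
  ∈-subtree {u} w = mk⇔ (λ w∈ → witness (reach? w u) (trans (sym lookup-subtree) ([]=⇒lookup w∈)))
                          (λ w→u → lookup⇒[]= w (subtree u) (trans lookup-subtree (dec-true (reach? w u) w→u)))
    where
      lookup-subtree : lookup (subtree u) w ≡ does (reach? w u)
      lookup-subtree = lookup∘tabulate (λ w → does (reach? w u)) w
      witness : ∀ {P : Set} (P? : Dec P) → does P? ≡ true → P
      witness (yes p) _ = p

  parent-unreachable : IsRootedTree par → ∀ {u v} → par u ≡ just v → ¬ Reach par v u
  parent-unreachable (_ , reaches-root) {u} {v} u→v (k , v→u) =
    let (K , u→root) = reaches-root u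
    in case trans (sym (iter-nothing-≤ (m≤m*n K (suc k)) u→root)) (loops K) of λ ()
    where
      loop : iter par (suc k) (just u) ≡ just u
      loop = trans (iter-suc k u) (trans (cong (iter par k) u→v) v→u)
      loops : ∀ m → iter par (m * suc k) (just u) ≡ just u
      loops zero    = refl
      loops (suc m) = trans (iter-+ (suc k) (m * suc k) (just u)) (trans (cong (iter par (suc k)) (loops m)) loop)

module Search {n : ℕ} (par : Parent n) (occ : Occ n) where
  open Paths par

  search-parks-free : ∀ k x {p} → proj₁ (search par occ k x) ≡ just p → occ p ≡ false
  search-parks-free (suc k) x parks with occ x in occx
  ... | false = subst (λ y → occ y ≡ false) (just-injective parks) occx
  ... | true with par x
  ...   | nothing with () ← parks
  ...   | just q  = search-parks-free k q parks

  search-parks-reachable : ∀ k x {p} → proj₁ (search par occ k x) ≡ just p → Reach par x p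
  search-parks-reachable (suc k) x parks with occ x
  ... | false = subst (Reach par x) (just-injective parks) reach-refl
  ... | true with par x in x→q
  ...   | nothing with () ← parks
  ...   | just q  = reach-trans (reach-parent x→q) (search-parks-reachable k q parks)

  search-crosses-reachable : ∀ k x {y} → y ∈ₗ proj₂ (search par occ k x) → Reach par x y
  search-crosses-reachable (suc k) x y∈ with occ x
  ... | true with par x in x→q
  ...   | just q with y∈
  ...     | here refl = reach-refl
  ...     | there y∈′ = reach-trans (reach-parent x→q) (search-crosses-reachable k q y∈′)

  search-after-crossing : ∀ k x {y v} → y ∈ₗ proj₂ (search par occ k x) → par y ≡ just v →
                          ∃ λ k′ → proj₁ (search par occ k x) ≡ proj₁ (search par occ k′ v)
  search-after-crossing (suc k) x y∈ y→v with occ x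
  ... | true with par x in x→q
  ...   | just q with y∈
  ...     | here refl = k , cong (λ q → proj₁ (search par occ k q)) (just-injective (trans (sym x→q) y→v))
  ...     | there y∈′ = search-after-crossing k q y∈′ y→v

  search-along-path : ∀ k x {u} j → iter par j (just x) ≡ just u → j < k →
                      (∃ λ p → proj₁ (search par occ k x) ≡ just p × Reach par p u)
                      ⊎ (occ u ≡ true × (u ∈ₗ proj₂ (search par occ k x) ⊎ par u ≡ nothing))
  search-along-path (suc k) x {u} j x→u j<k with occ x in occx
  ... | false = inj₁ (x , refl , j , x→u)
  ... | true with par x in x→q
  ...   | nothing = let x≡u = path-from-root j x→q x→u
                    in inj₂ (subst (λ y → occ y ≡ true) x≡u occx , inj₂ (subst (λ y → par y ≡ nothing) x≡u x→q))
  ...   | just q with x ≟ᶠ u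
  ...     | yes refl = inj₂ (occx , inj₁ (here refl))
  ...     | no  x≢u  with j′ , refl , q→u ← path-tail j x→u x≢u x→q
                     with search-along-path k q j′ q→u (≤-pred j<k)
  ...       | inj₁ parks             = inj₁ parks
  ...       | inj₂ (occu , blocked-at) = inj₂ (occu , map₁ there blocked-at)

module Run {n : ℕ} (par : Parent n) where

  spot : Occ n → Fin n → Maybe (Fin n)
  spot occ x = proj₁ (search par occ n x)

  crossed : Occ n → Fin n → List (Fin n)
  crossed occ x = proj₂ (search par occ n x)

  parkAt : Occ n → Maybe (Fin n) → Occ n
  parkAt occ nothing  = occ
  parkAt occ (just p) = occupy occ p

  after : Occ n → Fin n → Occ n
  after occ x = parkAt occ (spot occ x)

  final : Occ n → List (Fin n) → Occ n
  final occ []       = occ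
  final occ (x ∷ xs) = final (after occ x) xs

  run-parked-∷ : ∀ occ x xs → proj₁ (run par occ (x ∷ xs)) ≡ is-just (spot occ x) ∧ proj₁ (run par (after occ x) xs)
  run-parked-∷ occ x xs with search par occ n x
  ... | nothing , _ = refl
  ... | just _  , _ = refl

  run-used-∷ : ∀ occ x xs → proj₂ (run par occ (x ∷ xs)) ≡ crossed occ x ++ proj₂ (run par (after occ x) xs)
  run-used-∷ occ x xs with search par occ n x
  ... | nothing , _ = refl
  ... | just _  , _ = refl

  spot-free : ∀ occ x {p} → spot occ x ≡ just p → occ p ≡ false
  spot-free occ x = Search.search-parks-free par occ n x

  free-after : ∀ occ x → free occ ≡ bit (is-just (spot occ x)) + free (after occ x)
  free-after occ x with spot occ x in parks
  ... | nothing = refl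
  ... | just p  = free-occupy occ p (spot-free occ x parks)

  free≤ : ∀ occ ds → free occ ≤ length ds + free (final occ ds)
  free≤ occ []       = ≤-refl
  free≤ occ (x ∷ xs) = begin
    free occ                                     ≡⟨ free-after occ x ⟩
    bit (is-just (spot occ x)) + free (after occ x) ≤⟨ +-mono-≤ (bit≤1 _) (free≤ (after occ x) xs) ⟩
    suc (length xs + free (final (after occ x) xs)) ∎
    where open ≤-Reasoning

  all-parked⇒free≡ : ∀ occ ds → proj₁ (run par occ ds) ≡ true → free occ ≡ length ds + free (final occ ds)
  all-parked⇒free≡ occ []       _      = refl
  all-parked⇒free≡ occ (x ∷ xs) parked =
    let (x-parks , xs-park) = ∧-true (trans (sym (run-parked-∷ occ x xs)) parked)
    in begin
      free occ                                        ≡⟨ free-after occ x ⟩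
      bit (is-just (spot occ x)) + free (after occ x) ≡⟨ cong (λ b → bit b + free (after occ x)) x-parks ⟩
      suc (free (after occ x))                        ≡⟨ cong suc (all-parked⇒free≡ (after occ x) xs xs-park) ⟩
      suc (length xs + free (final (after occ x) xs)) ∎
    where open ≡-Reasoning

  stranded⇒free< : ∀ occ ds → proj₁ (run par occ ds) ≡ false → free occ < length ds + free (final occ ds)
  stranded⇒free< occ (x ∷ xs) stranded with ∧-false (trans (sym (run-parked-∷ occ x xs)) stranded)
  ... | inj₁ x-strands = s≤s (begin
    free occ                                        ≡⟨ free-after occ x ⟩
    bit (is-just (spot occ x)) + free (after occ x) ≡⟨ cong (λ b → bit b + free (after occ x)) x-strands ⟩
    free (after occ x)                              ≤⟨ free≤ (after occ x) xs ⟩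
    length xs + free (final (after occ x) xs)       ∎)
    where open ≤-Reasoning
  ... | inj₂ xs-strand = begin-strict
    free occ                                        ≡⟨ free-after occ x ⟩
    bit (is-just (spot occ x)) + free (after occ x) <⟨ +-mono-≤-< (bit≤1 _) (stranded⇒free< (after occ x) xs xs-strand) ⟩
    suc (length xs + free (final (after occ x) xs)) ∎
    where open ≤-Reasoning

  after-≤ : ∀ occ x w → occ w ≤ᵇ after occ x w
  after-≤ occ x w with spot occ x
  ... | nothing = ≤ᵇ-refl
  ... | just p  = occupy-≤ occ p w

  final-free⇒free : ∀ occ ds w → final occ ds w ≡ false → occ w ≡ false
  final-free⇒free occ []       w free-at-end = free-at-end
  final-free⇒free occ (x ∷ xs) w free-at-end =
    ≤ᵇ-false (after-≤ occ x w) (final-free⇒free (after occ x) xs w free-at-end)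

demand : ∀ {n} → Subset n → List (Fin n) → ℕ
demand A []       = 0
demand A (x ∷ xs) = bit (does (x ∈? A)) + demand A xs

module Subtree {n : ℕ} (par : Parent n) {u : Fin n} {A : Subset n} (∈A : ∀ w → w ∈ A ⇔ Reach par w u) where
  open Paths par
  open Run par

  spot∈⇒pref∈ : ∀ occ x {p} → spot occ x ≡ just p → p ∈ A → x ∈ A
  spot∈⇒pref∈ occ x parks p∈A =
    from (∈A x) (reach-trans (Search.search-parks-reachable par occ n x parks) (to (∈A _) p∈A))

  crosses⇒pref∈ : ∀ occ x → u ∈ₗ crossed occ x → x ∈ A
  crosses⇒pref∈ occ x u∈ = from (∈A x) (Search.search-crosses-reachable par occ n x u∈)

  parks-inside : ∀ occ x {p} → spot occ x ≡ just p → p ∈ A → load A (after occ x) ≡ suc (load A occ)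
  parks-inside occ x parks p∈A rewrite parks = load-occupy-∈ occ (spot-free occ x parks) p∈A

  parks-outside : ∀ occ x → (∀ p → spot occ x ≡ just p → p ∉ A) → load A (after occ x) ≡ load A occ
  parks-outside occ x not-in with spot occ x
  ... | nothing = refl
  ... | just p  = load-occupy-∉ occ (not-in p refl)

  load-after-mono : ∀ occ x → load A occ ≤ load A (after occ x)
  load-after-mono occ x with spot occ x
  ... | nothing = ≤-refl
  ... | just p  = load-occupy-≥ A occ p

  load-after≤ : ∀ occ x → load A (after occ x) ≤ load A occ + bit (does (x ∈? A))
  load-after≤ occ x with spot occ x in parks
  ... | nothing = m≤m+n _ _
  ... | just p with p ∈? A
  ...   | yes p∈A rewrite dec-true (x ∈? A) (spot∈⇒pref∈ occ x parks p∈A) =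
    ≤-reflexive (trans (load-occupy-∈ occ (spot-free occ x parks) p∈A) (+-comm 1 _))
  ...   | no  p∉A = ≤-trans (≤-reflexive (load-occupy-∉ occ p∉A)) (m≤m+n _ _)

  Blocked : Occ n → Fin n → Set
  Blocked occ x = occ u ≡ true × (u ∈ₗ crossed occ x ⊎ par u ≡ nothing)

  parks-inside-unless-blocked : ∀ occ x → x ∈ A → (∃ λ p → spot occ x ≡ just p × p ∈ A) ⊎ Blocked occ x
  parks-inside-unless-blocked occ x x∈A =
    -- the search only has fuel n, hence the detour through a path to u of length below n
    let (j , x→u)       = to (∈A x) x∈A
        (k , k<n , x→′u) = path-bounded j x→u
    in map₁ (λ (p , parks , p→u) → p , parks , from (∈A p) p→u)
            (Search.search-along-path par occ n x k x→′u k<n)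

  load-after-≥ : ∀ occ x → ¬ Blocked occ x → load A occ + bit (does (x ∈? A)) ≤ load A (after occ x)
  load-after-≥ occ x unblocked with x ∈? A
  ... | no  _   = subst (_≤ load A (after occ x)) (sym (+-identityʳ _)) (load-after-mono occ x)
  ... | yes x∈A with parks-inside-unless-blocked occ x x∈A
  ...   | inj₁ (p , parks , p∈A) = ≤-reflexive (sym (trans (parks-inside occ x parks p∈A) (+-comm 1 _)))
  ...   | inj₂ blocked           = ⊥-elim (unblocked blocked)

  load-final≤ : ∀ occ ds → load A (final occ ds) ≤ load A occ + demand A ds
  load-final≤ occ []       = m≤m+n _ _
  load-final≤ occ (x ∷ xs) = begin
    load A (final (after occ x) xs)                     ≤⟨ load-final≤ (after occ x) xs ⟩
    load A (after occ x) + demand A xs                  ≤⟨ +-monoˡ-≤ (demand A xs) (load-after≤ occ x) ⟩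
    load A occ + bit (does (x ∈? A)) + demand A xs      ≡⟨ +-assoc (load A occ) _ _ ⟩
    load A occ + demand A (x ∷ xs)                      ∎
    where open ≤-Reasoning

  unblocked⇒load-final≥ : (Unblocked : Occ n → List (Fin n) → Set) →
                          (∀ {occ x xs} → Unblocked occ (x ∷ xs) → ¬ Blocked occ x × Unblocked (after occ x) xs) →
                          ∀ occ ds → Unblocked occ ds → load A occ + demand A ds ≤ load A (final occ ds)
  unblocked⇒load-final≥ Unblocked step occ []       _         = ≤-reflexive (+-identityʳ _)
  unblocked⇒load-final≥ Unblocked step occ (x ∷ xs) unblocked =
    let (x-unblocked , xs-unblocked) = step unblocked
    in begin
      load A occ + demand A (x ∷ xs)                 ≡⟨ +-assoc (load A occ) _ _ ⟨
      load A occ + bit (does (x ∈? A)) + demand A xs ≤⟨ +-monoˡ-≤ (demand A xs) (load-after-≥ occ x x-unblocked) ⟩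
      load A (after occ x) + demand A xs             ≤⟨ unblocked⇒load-final≥ Unblocked step (after occ x) xs xs-unblocked ⟩
      load A (final (after occ x) xs)                ∎
    where open ≤-Reasoning

  free-at-end⇒load-final≥ : ∀ occ ds → final occ ds u ≡ false → load A occ + demand A ds ≤ load A (final occ ds)
  free-at-end⇒load-final≥ = unblocked⇒load-final≥ (λ occ ds → final occ ds u ≡ false) λ {occ} {x} {xs} free-at-end →
    (λ (occupied , _) → case trans (sym occupied) (final-free⇒free occ (x ∷ xs) u free-at-end) of λ ())
    , free-at-end

  module WithParent {v : Fin n} (u→v : par u ≡ just v) (v↛u : ¬ Reach par v u) where

    crosses⇒parks-outside : ∀ occ x → u ∈ₗ crossed occ x → ∀ p → spot occ x ≡ just p → p ∉ A
    crosses⇒parks-outside occ x u∈ p parks p∈A =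
      let (k , same-spot) = Search.search-after-crossing par occ n x u∈ u→v
      in v↛u (reach-trans (Search.search-parks-reachable par occ k v (trans (sym same-spot) parks)) (to (∈A p) p∈A))

    load-after-crossing : ∀ occ x → u ∈ₗ crossed occ x → load A (after occ x) < load A occ + bit (does (x ∈? A))
    load-after-crossing occ x u∈ rewrite dec-true (x ∈? A) (crosses⇒pref∈ occ x u∈) =
      ≤-reflexive (trans (cong suc (parks-outside occ x (crosses⇒parks-outside occ x u∈))) (+-comm 1 _))

    used⇒load-final< : ∀ occ ds → u ∈ₗ proj₂ (run par occ ds) → load A (final occ ds) < load A occ + demand A ds
    used⇒load-final< occ (x ∷ xs) u∈ with ∈-++⁻ (crossed occ x) (subst (u ∈ₗ_) (run-used-∷ occ x xs) u∈)
    ... | inj₁ u∈crossed = begin-strict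
      load A (final (after occ x) xs)                ≤⟨ load-final≤ (after occ x) xs ⟩
      load A (after occ x) + demand A xs             <⟨ +-monoˡ-< (demand A xs) (load-after-crossing occ x u∈crossed) ⟩
      load A occ + bit (does (x ∈? A)) + demand A xs ≡⟨ +-assoc (load A occ) _ _ ⟩
      load A occ + demand A (x ∷ xs)                 ∎
      where open ≤-Reasoning
    ... | inj₂ u∈used = begin-strict
      load A (final (after occ x) xs)                <⟨ used⇒load-final< (after occ x) xs u∈used ⟩
      load A (after occ x) + demand A xs             ≤⟨ +-monoˡ-≤ (demand A xs) (load-after≤ occ x) ⟩
      load A occ + bit (does (x ∈? A)) + demand A xs ≡⟨ +-assoc (load A occ) _ _ ⟩
      load A occ + demand A (x ∷ xs)                 ∎
      where open ≤-Reasoning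

    unused⇒load-final≥ : ∀ occ ds → u ∉ₗ proj₂ (run par occ ds) → load A occ + demand A ds ≤ load A (final occ ds)
    unused⇒load-final≥ = unblocked⇒load-final≥ (λ occ ds → u ∉ₗ proj₂ (run par occ ds)) λ {occ} {x} {xs} u∉ →
      let u∉′ = u∉ ∘ subst (u ∈ₗ_) (sym (run-used-∷ occ x xs))
      in (λ { (_ , inj₁ u∈crossed) → u∉′ (∈-++⁺ˡ u∈crossed)
            ; (_ , inj₂ u-root)    → case trans (sym u→v) u-root of λ () })
         , u∉′ ∘ ∈-++⁺ʳ (crossed occ x)

demand-tabulate : ∀ {n m} A (g : Fin m → Fin n) → demand A (tabulate g) ≡ count (λ i → does (g i ∈? A))
demand-tabulate {m = zero}  A g = refl
demand-tabulate {m = suc m} A g = cong (bit (does (g zero ∈? A)) +_) (demand-tabulate A (g ∘ suc))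

demand-drivers : ∀ {n} (s : Fin n → Fin n) A → demand A (drivers s) ≡ ∣ preimage s A ∣
demand-drivers s A = trans (demand-tabulate A s) (sym (∣tabulate∣≡count (λ i → does (s i ∈? A))))

preimage-permute : ∀ {n} (s : Fin n → Fin n) A (σ : Permutation′ n) →
                   ∣ preimage s A ∣ ≡ ∣ preimage (s ∘ (σ ⟨$⟩ʳ_)) A ∣
preimage-permute s A σ = begin
  ∣ preimage s A ∣                          ≡⟨ ∣tabulate∣≡count (λ i → does (s i ∈? A)) ⟩
  count (λ i → does (s i ∈? A))             ≡⟨ count-permute (λ i → does (s i ∈? A)) σ ⟩
  count (λ i → does (s (σ ⟨$⟩ʳ i) ∈? A))   ≡⟨ ∣tabulate∣≡count (λ i → does (s (σ ⟨$⟩ʳ i) ∈? A)) ⟨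
  ∣ preimage (s ∘ (σ ⟨$⟩ʳ_)) A ∣            ∎
  where open ≡-Reasoning

module Parking {n : ℕ} (par : Parent n) (s : Fin n → Fin n) where
  open Paths par
  open Run par
  open import Data.List.Membership.DecPropositional (_≟ᶠ_ {n}) using () renaming (_∈?_ to _∈ₗ?_)

  end : Occ n
  end = final emptyOcc (drivers s)

  initial-load : ∀ A → load A emptyOcc + demand A (drivers s) ≡ ∣ preimage s A ∣
  initial-load A = trans (cong (_+ demand A (drivers s)) (load-empty A)) (demand-drivers s A)

  free-start : free (emptyOcc {n}) ≡ length (drivers s)
  free-start = trans free-empty (sym (length-tabulate s))

  parking⇒end-full : IsParkingFunction par s → ∀ w → end w ≡ true
  parking⇒end-full parked = free≡0⇒full end (sym (+-cancelˡ-≡ (length (drivers s)) 0 (free end)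
    (trans (+-identityʳ _) (trans (sym free-start) (all-parked⇒free≡ emptyOcc (drivers s) parked)))))

  stranded⇒end-free : proj₁ (run par emptyOcc (drivers s)) ≡ false → ∃ λ w → end w ≡ false
  stranded⇒end-free stranded =
    let (w , free-w) = count-witness (not ∘ end) (+-cancelˡ-< (length (drivers s)) 0 (free end)
          (subst (_< length (drivers s) + free end) (trans free-start (sym (+-identityʳ _)))
                 (stranded⇒free< emptyOcc (drivers s) stranded)))
    in w , trans (sym (not-involutive (end w))) (cong not free-w)

  parking⇒covered : IsParkingFunction par s → ∀ {u A} → (∀ w → w ∈ A ⇔ Reach par w u) →
                    ∣ A ∣ ≤ ∣ preimage s A ∣
  parking⇒covered parked {A = A} ∈A = begin
    ∣ A ∣                                      ≡⟨ load-full A end (parking⇒end-full parked) ⟨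
    load A end                                 ≤⟨ Subtree.load-final≤ par ∈A emptyOcc (drivers s) ⟩
    load A emptyOcc + demand A (drivers s)     ≡⟨ initial-load A ⟩
    ∣ preimage s A ∣                           ∎
    where open ≤-Reasoning

  covered⇒parking : (∀ u → ∣ subtree u ∣ ≤ ∣ preimage s (subtree u) ∣) → IsParkingFunction par s
  covered⇒parking covered with proj₁ (run par emptyOcc (drivers s)) in parked
  ... | true  = refl
  ... | false = let (w , free-w) = stranded⇒end-free parked in ⊥-elim (<⇒≱ (begin-strict
    ∣ preimage s (subtree w) ∣                                   ≡⟨ initial-load (subtree w) ⟨
    load (subtree w) emptyOcc + demand (subtree w) (drivers s)
      ≤⟨ Subtree.free-at-end⇒load-final≥ par ∈-subtree emptyOcc (drivers s) free-w ⟩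
    load (subtree w) end                                         <⟨ load<∣A∣ end (from (∈-subtree w) reach-refl) free-w ⟩
    ∣ subtree w ∣                                                ∎) (covered w))
    where open ≤-Reasoning

  used⇔overloaded : IsRootedTree par → IsParkingFunction par s → ∀ {u v} → par u ≡ just v →
                    ∀ {A} → (∀ w → w ∈ A ⇔ Reach par w u) → Used par s u ⇔ (∣ A ∣ < ∣ preimage s A ∣)
  used⇔overloaded tree parked {u} u→v {A} ∈A = mk⇔ used⇒overloaded overloaded⇒used
    where
      open Subtree par ∈A
      open WithParent u→v (parent-unreachable tree u→v)
      end-load : load A end ≡ ∣ A ∣
      end-load = load-full A end (parking⇒end-full parked)
      used⇒overloaded : Used par s u → ∣ A ∣ < ∣ preimage s A ∣
      used⇒overloaded used = subst₂ _<_ end-load (initial-load A) (used⇒load-final< emptyOcc (drivers s) used)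
      overloaded⇒used : ∣ A ∣ < ∣ preimage s A ∣ → Used par s u
      overloaded⇒used overloaded with u ∈ₗ? proj₂ (run par emptyOcc (drivers s))
      ... | yes used   = used
      ... | no  unused = ⊥-elim (<⇒≱ overloaded
              (subst₂ _≤_ (initial-load A) end-load (unused⇒load-final≥ emptyOcc (drivers s) unused)))

parking-permute : ∀ {n} (par : Parent n) (s : Fin n → Fin n) → IsParkingFunction par s →
                  (σ : Permutation′ n) → IsParkingFunction par (s ∘ (σ ⟨$⟩ʳ_))
parking-permute par s parked σ = Parking.covered⇒parking par (s ∘ (σ ⟨$⟩ʳ_)) λ u →
  subst (∣ subtree u ∣ ≤_) (preimage-permute s (subtree u) σ) (Parking.parking⇒covered par s parked ∈-subtree)
  where open Paths par

proposition2p4 : ∀ {n} (par : Parent n) (s : Fin n → Fin n)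
    → IsRootedTree par → IsParkingFunction par s
    → (∀ (u v : Fin n) → par u ≡ just v
         → (A : Subset n) → (∀ w → (w ∈ A) ⇔ Reach par w u)
         → Used par s u ⇔ (∣ A ∣ < ∣ preimage s A ∣))
      × (∀ (σ : Permutation′ n) (u v : Fin n) → par u ≡ just v
         → Used par s u ⇔ Used par (s ∘ (σ ⟨$⟩ʳ_)) u)
proposition2p4 par s tree parked =
    (λ u v u→v A ∈A → used⇔overloaded par s tree parked u→v ∈A)
  , λ σ u v u→v →
      ⇔-trans (used⇔overloaded par s tree parked u→v ∈-subtree)
              (subst (λ k → (∣ subtree u ∣ < k) ⇔ Used par (s ∘ (σ ⟨$⟩ʳ_)) u)
                     (sym (preimage-permute s (subtree u) σ))
                     (⇔-sym (used⇔overloaded par (s ∘ (σ ⟨$⟩ʳ_)) tree (parking-permute par s parked σ)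
                                             u→v ∈-subtree)))
  where
    open Parking using (used⇔overloaded)
    open Paths par
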